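{- Any randomized streaming algorithm in the vertex arrival model on $n$-vertex graphs that, with probability at least $3/4$, simultaneously reports all vertices with identical neighborhoods must use $\Omega(n\log n)$ bits of space.
   Context: Vertex arrival model: a graph $G=(V,E)$ with $|V|=n$ is given as a stream in which each update is a vertex together with the list of all its neighbors. The neighborhood of $v$ is $\mathcal N(v)=\{u:(u,v)\in E\}$; the algorithm must identify all pairs $u,v$ with $\mathcal N(u)=\mathcal N(v)$. -}

module Defs where

open import Data.Nat using (ℕ; suc; _*_; _≤_)
open import Data.Bool using (Bool)
open import Data.Fin using (Fin)
open import Data.Fin.Permutation using (Permutation′; _⟨$⟩ʳ_)
open import Data.Vec using (Vec)
open import Data.List using (List; []; _∷_; length; filter; allFin)
open import Relation.Binary.PropositionalEquality using (_≡_; _≢_)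
open import Relation.Unary using (Decidable)
open import Relation.Nullary using (Dec; ¬?)
open import Relation.Nullary.Decidable using (_×-dec_; _→-dec_)
open import Data.Fin.Properties using (all?)
import Data.Bool.Properties

record Graph (n : ℕ) : Set where
  field
    adj   : Fin n → Fin n → Bool
    sym   : ∀ u v → adj u v ≡ adj v u
    irrefl : ∀ v → adj v v ≡ Data.Bool.false

open Graph public

SameNbhd : ∀ {n} → Graph n → Fin n → Fin n → Set
SameNbhd G u v = ∀ w → adj G u w ≡ adj G v w

-- A randomized streaming algorithm on n-vertex graphs using s bits of
-- memory (memory state = Vec Bool s) and a random seed drawn uniformly
-- from Fin m (arbitrary finite randomness; m ≥ 1 required in the theorem).
-- The seed is available at every step (public/read-only randomness).
record StreamAlg (n s m : ℕ) : Set where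
  field
    init : Fin m → Vec Bool s
    step : Fin m → Vec Bool s → Fin n → (Fin n → Bool) → Vec Bool s
    -- final report: out r σ u v = true means "u and v have identical
    -- neighbourhoods"
    out  : Fin m → Vec Bool s → Fin n → Fin n → Bool

open StreamAlg public

runList : ∀ {n s m} → StreamAlg n s m → Fin m → Vec Bool s →
          List (Fin n) → (Fin n → Fin n → Bool) → Vec Bool s
runList A r σ []       adjG = σ
runList A r σ (v ∷ vs) adjG = runList A r (step A r σ v (adjG v)) vs adjG

run : ∀ {n s m} → StreamAlg n s m → Fin m → Graph n → Permutation′ n → Vec Bool s
run A r G π = runList A r (init A r) (Data.List.map (π ⟨$⟩ʳ_) (allFin _)) (adj G)

Correct : ∀ {n s m} → StreamAlg n s m → Graph n → Permutation′ n → Fin m → Set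
Correct A G π r =
  ∀ u v → u ≢ v → (out A r (run A r G π) u v ≡ Data.Bool.true → SameNbhd G u v)
                × (SameNbhd G u v → out A r (run A r G π) u v ≡ Data.Bool.true)
  where open import Data.Product using (_×_)

SameNbhd? : ∀ {n} (G : Graph n) u v → Dec (SameNbhd G u v)
SameNbhd? G u v = all? (λ w → adj G u w Data.Bool.Properties.≟ adj G v w)

Correct? : ∀ {n s m} (A : StreamAlg n s m) G π → Decidable (Correct A G π)
Correct? A G π r =
  all? λ u → all? λ v → (¬? (u Data.Fin.Properties.≟ v)) →-dec
    ((((out A r (run A r G π) u v Data.Bool.Properties.≟ Data.Bool.true)) →-dec SameNbhd? G u v)
     ×-dec (SameNbhd? G u v →-dec (out A r (run A r G π) u v Data.Bool.Properties.≟ Data.Bool.true)))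

goodSeeds : ∀ {n s m} → StreamAlg n s m → Graph n → Permutation′ n → ℕ
goodSeeds A G π = length (filter (Correct? A G π) (allFin _))

-- Success probability ≥ 3/4 (seed uniform on Fin m) on every graph and
-- every arrival order:  #{good seeds} / m ≥ 3/4.
Succeeds : ∀ {n s m} → StreamAlg n s m → Set
Succeeds {n} {s} {m} A =
  ∀ (G : Graph n) (π : Permutation′ n) → 3 * m ≤ 4 * goodSeeds A G π

-- For f : Fin k → Fin k consider the graph in which hub j is adjacent to anchor j and to every item i
-- with f i = j.  Item i and anchor j then have the same neighbourhood exactly when f i = j, so for a
-- fixed seed a run that is correct on this graph determines f from its final memory state: each seed
-- is correct on at most 2 ^ s of the k ^ k graphs.  Counting the pairs (graph, correct seed) in two
-- ways turns success probability 3/4 into 3 k ^ k ≤ 4 · 2 ^ s, i.e. k log k ≤ s + 2, and k = ⌊n/3⌋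
-- gives n log n = O(s).
module Submission where

open import Defs hiding (sym)
open import Algebra.Properties.CommutativeSemigroup as CommutativeSemigroupProperties using ()
open import Data.Bool using (Bool; true; false; _∨_; T)
open import Data.Bool.Properties using (∨-comm) renaming (_≟_ to _≟ᵇ_)
open import Data.Fin using (Fin; _↑ˡ_; _↑ʳ_; splitAt; finToFun; funToFin; combine)
open import Data.Fin.Properties using (_≟_; splitAt-↑ˡ; splitAt-↑ʳ; funToFin-finToFin)
import Data.Fin.Permutation as Perm
open import Data.List using (List; []; _∷_; length; map; filter; allFin)
open import Data.List.Properties using (length-map; length-tabulate)
open import Data.List.Relation.Unary.All as All using (All; []; _∷_)
open import Data.List.Relation.Unary.All.Properties using (all-filter) renaming (map⁺ to All-map⁺)
open import Data.List.Relation.Unary.AllPairs using ([]; _∷_)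
open import Data.List.Relation.Unary.Unique.Propositional using (Unique)
import Data.List.Relation.Unary.Unique.Propositional.Properties as Unique
open import Data.Nat using (ℕ; zero; suc; _+_; _*_; _^_; _≤_; _<_; z≤n; s≤s; NonZero; ⌊_/2⌋; ⌈_/2⌉; _/_; _%_)
open import Data.Nat.DivMod using (m≡m%n+[m/n]*n; m%n≤n; /-monoˡ-≤)
open import Data.Nat.ListAction using (sum)
open import Data.Nat.Logarithm using (⌊log₂_⌋; ⌊log₂⌋-mono-≤; ⌊log₂[2*b]⌋≡1+⌊log₂b⌋; ⌊log₂[2^n]⌋≡n)
open import Data.Nat.Logarithm.Core using (⌊log2⌋)
open import Data.Nat.Properties
  using (≤-trans; ≤-reflexive; n≤1+n; m≤n*m; +-identityʳ; +-suc; *-suc; *-assoc; *-distribˡ-+; ^-*-assoc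
        ; +-mono-≤; +-monoʳ-≤; +-monoˡ-≤; +-cancelˡ-≤; *-mono-≤; *-monoʳ-≤; *-cancelʳ-≤; ^-monoˡ-≤
        ; ⌊n/2⌋≤⌈n/2⌉; ⌊n/2⌋+⌈n/2⌉≡n; +-commutativeSemigroup; *-commutativeSemigroup; module ≤-Reasoning)
open import Data.Nat.Tactic.RingSolver using (solve-∀)
open import Data.Product using (∃; _,_; proj₁; proj₂)
open import Data.Sum using ([_,_]′)
open import Data.Vec using (Vec; []; _∷_; head; tail)
open import Function using (_∘_; const; id)
open import Induction.WellFounded using (Acc; acc)
open import Relation.Binary.PropositionalEquality
open import Relation.Nullary using (Dec; yes; no)
open import Relation.Nullary.Decidable using (⌊_⌋; toWitness; fromWitness)
open import Relation.Unary using (Decidable)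

module +-Props = CommutativeSemigroupProperties +-commutativeSemigroup
module *-Props = CommutativeSemigroupProperties *-commutativeSemigroup

map-injectiveOn⁺ : ∀ {A B : Set} {P : A → Set} (f : A → B) →
                   (∀ {x y} → P x → P y → f x ≡ f y → x ≡ y) →
                   ∀ {xs} → All P xs → Unique xs → Unique (map f xs)
map-injectiveOn⁺ f inj {[]}     []         []          = []
map-injectiveOn⁺ f inj {x ∷ xs} (px ∷ pxs) (x∉xs ∷ u) =
  All-map⁺ (All.zipWith (λ (py , x≢y) fx≡fy → x≢y (inj px py fx≡fy)) (pxs , x∉xs))
    ∷ map-injectiveOn⁺ f inj pxs u

withHead : ∀ {s} → Bool → List (Vec Bool (suc s)) → List (Vec Bool s)
withHead b = map tail ∘ filter ((_≟ᵇ b) ∘ head)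

length-withHead : ∀ {s} (xs : List (Vec Bool (suc s))) →
                  length xs ≡ length (withHead true xs) + length (withHead false xs)
length-withHead [] = refl
length-withHead ((true  ∷ _) ∷ xs) = cong suc (length-withHead xs)
length-withHead ((false ∷ _) ∷ xs) = trans (cong suc (length-withHead xs)) (sym (+-suc _ _))

withHead-unique : ∀ {s} b {xs : List (Vec Bool (suc s))} → Unique xs → Unique (withHead b xs)
withHead-unique b {xs} u =
  map-injectiveOn⁺ tail sameHead (all-filter headIs? xs) (Unique.filter⁺ headIs? u)
  where
  headIs? = (_≟ᵇ b) ∘ head
  sameHead : ∀ {x y : Vec Bool _} → head x ≡ b → head y ≡ b → tail x ≡ tail y → x ≡ y
  sameHead {_ ∷ _} {_ ∷ _} refl refl refl = refl

Unique⇒length≤2^ : ∀ s {xs : List (Vec Bool s)} → Unique xs → length xs ≤ 2 ^ s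
Unique⇒length≤2^ zero    {[]}          _                = z≤n
Unique⇒length≤2^ zero    {[] ∷ []}     _                = s≤s z≤n
Unique⇒length≤2^ zero    {[] ∷ [] ∷ _} ((≢[] ∷ _) ∷ _) with () ← ≢[] refl
Unique⇒length≤2^ (suc s) {xs}          u                = begin
  length xs                                             ≡⟨ length-withHead xs ⟩
  length (withHead true xs) + length (withHead false xs) ≤⟨ +-mono-≤ (bound true) (bound false) ⟩
  2 ^ s + 2 ^ s                                         ≡⟨ cong (2 ^ s +_) (sym (+-identityʳ (2 ^ s))) ⟩
  2 ^ suc s                                             ∎
  where
  open ≤-Reasoning
  bound : ∀ b → length (withHead b xs) ≤ 2 ^ s
  bound b = Unique⇒length≤2^ s (withHead-unique b u)

count : ∀ {A : Set} {P : A → Set} → Decidable P → List A → ℕ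
count P? = length ∘ filter P?

module _ {A B : Set} {R : A → B → Set} (R? : ∀ x y → Dec (R x y)) where

  column : B → List A → ℕ
  column y = count (λ x → R? x y)

  sum-column-∷ : ∀ x xs ys → sum (map (λ y → column y (x ∷ xs)) ys)
                           ≡ count (R? x) ys + sum (map (λ y → column y xs) ys)
  sum-column-∷ x xs []       = refl
  sum-column-∷ x xs (y ∷ ys) with R? x y | sum-column-∷ x xs ys
  ... | yes _ | ih = cong suc (trans (cong (column y xs +_) ih) (+-Props.x∙yz≈y∙xz (column y xs) (count (R? x) ys) _))
  ... | no  _ | ih = trans (cong (column y xs +_) ih) (+-Props.x∙yz≈y∙xz (column y xs) (count (R? x) ys) _)

  sum-count-swap : ∀ xs ys → sum (map (λ x → count (R? x) ys) xs) ≡ sum (map (λ y → column y xs) ys)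
  sum-count-swap []       ys = sym (sum-zeros ys)
    where
    sum-zeros : ∀ ys → sum (map (λ y → column y []) ys) ≡ 0
    sum-zeros []       = refl
    sum-zeros (_ ∷ ys) = sum-zeros ys
  sum-count-swap (x ∷ xs) ys =
    trans (cong (count (R? x) ys +_) (sum-count-swap xs ys)) (sym (sum-column-∷ x xs ys))

sum-map-≤ : ∀ {A : Set} (f : A → ℕ) {b} xs → (∀ x → f x ≤ b) → sum (map f xs) ≤ length xs * b
sum-map-≤ f []       _  = z≤n
sum-map-≤ f (x ∷ xs) f≤ = +-mono-≤ (f≤ x) (sum-map-≤ f xs f≤)

sum-map-≥ : ∀ {A : Set} (f : A → ℕ) c {a} xs → (∀ x → a ≤ c * f x) →
            length xs * a ≤ c * sum (map f xs)
sum-map-≥ f c []       _  = z≤n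
sum-map-≥ f c {a} (x ∷ xs) a≤ = begin
  a + length xs * a                  ≤⟨ +-mono-≤ (a≤ x) (sum-map-≥ f c xs a≤) ⟩
  c * f x + c * sum (map f xs)       ≡⟨ sym (*-distribˡ-+ c (f x) _) ⟩
  c * (f x + sum (map f xs))         ∎
  where open ≤-Reasoning

2*⌊n/2⌋≤n : ∀ n → 2 * ⌊ n /2⌋ ≤ n
2*⌊n/2⌋≤n n = begin
  ⌊ n /2⌋ + (⌊ n /2⌋ + 0) ≡⟨ cong (⌊ n /2⌋ +_) (+-identityʳ ⌊ n /2⌋) ⟩
  ⌊ n /2⌋ + ⌊ n /2⌋       ≤⟨ +-monoʳ-≤ ⌊ n /2⌋ (⌊n/2⌋≤⌈n/2⌉ n) ⟩
  ⌊ n /2⌋ + ⌈ n /2⌉       ≡⟨ ⌊n/2⌋+⌈n/2⌉≡n n ⟩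
  n                       ∎
  where open ≤-Reasoning

2^⌊log2⌋≤ : ∀ n {rec : Acc _<_ (suc n)} → 2 ^ ⌊log2⌋ (suc n) rec ≤ suc n
2^⌊log2⌋≤ zero                = s≤s z≤n
2^⌊log2⌋≤ (suc n) {acc rs} = begin
  2 * 2 ^ ⌊log2⌋ (suc ⌊ n /2⌋) _ ≤⟨ *-monoʳ-≤ 2 (2^⌊log2⌋≤ ⌊ n /2⌋) ⟩
  2 * suc ⌊ n /2⌋                ≡⟨ *-suc 2 ⌊ n /2⌋ ⟩
  2 + 2 * ⌊ n /2⌋                ≤⟨ +-monoʳ-≤ 2 (2*⌊n/2⌋≤n n) ⟩
  2 + n                          ∎
  where open ≤-Reasoning

2^⌊log₂n⌋≤n : ∀ n .{{_ : NonZero n}} → 2 ^ ⌊log₂ n ⌋ ≤ n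
2^⌊log₂n⌋≤n (suc n) = 2^⌊log2⌋≤ n

2^m≤2^n⇒m≤n : ∀ {m n} → 2 ^ m ≤ 2 ^ n → m ≤ n
2^m≤2^n⇒m≤n {m} {n} le = subst₂ _≤_ (⌊log₂[2^n]⌋≡n m) (⌊log₂[2^n]⌋≡n n) (⌊log₂⌋-mono-≤ le)

⌊log₂a⌋*b≤ : ∀ a b s .{{_ : NonZero a}} → a ^ b ≤ 2 ^ s → ⌊log₂ a ⌋ * b ≤ s
⌊log₂a⌋*b≤ a b s aᵇ≤2ˢ = 2^m≤2^n⇒m≤n (begin
  2 ^ (⌊log₂ a ⌋ * b) ≡⟨ ^-*-assoc 2 ⌊log₂ a ⌋ b ⟨
  (2 ^ ⌊log₂ a ⌋) ^ b ≤⟨ ^-monoˡ-≤ b (2^⌊log₂n⌋≤n a) ⟩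
  a ^ b               ≤⟨ aᵇ≤2ˢ ⟩
  2 ^ s               ∎)
  where open ≤-Reasoning

n⌊log₂n⌋≤16s : ∀ {k n s} → 4 ≤ k → n ≤ 4 * k → 3 * k ^ k ≤ 4 * 2 ^ s → n * ⌊log₂ n ⌋ ≤ 16 * s
n⌊log₂n⌋≤16s {k@(suc _)} {n} {s} 4≤k n≤4k 3kᵏ≤4·2ˢ = begin
  n * ⌊log₂ n ⌋          ≤⟨ *-mono-≤ n≤4k ⌊log₂n⌋≤L+L ⟩
  4 * k * (L + L)        ≡⟨ regroup k L ⟩
  8 * (L * k)            ≤⟨ *-monoʳ-≤ 8 Lk≤2+s ⟩
  8 * (2 + s)            ≤⟨ *-monoʳ-≤ 8 (+-monoˡ-≤ s 2≤s) ⟩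
  8 * (s + s)            ≡⟨ double s ⟩
  16 * s                 ∎
  where
  open ≤-Reasoning
  regroup : ∀ k L → 4 * k * (L + L) ≡ 8 * (L * k)
  regroup = solve-∀
  double : ∀ s → 8 * (s + s) ≡ 16 * s
  double = solve-∀
  L = ⌊log₂ k ⌋
  2≤L : 2 ≤ L
  2≤L = ⌊log₂⌋-mono-≤ 4≤k
  Lk≤2+s : L * k ≤ 2 + s
  Lk≤2+s = ⌊log₂a⌋*b≤ k k (2 + s) (begin
    k ^ k         ≤⟨ m≤n*m (k ^ k) 3 ⟩
    3 * k ^ k     ≤⟨ 3kᵏ≤4·2ˢ ⟩
    4 * 2 ^ s     ≡⟨ *-assoc 2 2 (2 ^ s) ⟩
    2 ^ (2 + s)   ∎)
  2≤s : 2 ≤ s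
  2≤s = +-cancelˡ-≤ 2 2 s (≤-trans (m≤n*m 4 2) (≤-trans (*-mono-≤ 2≤L 4≤k) Lk≤2+s))
  ⌊log₂n⌋≤L+L : ⌊log₂ n ⌋ ≤ L + L
  ⌊log₂n⌋≤L+L = begin
    ⌊log₂ n ⌋             ≤⟨ ⌊log₂⌋-mono-≤ (≤-trans n≤4k (≤-reflexive (*-assoc 2 2 k))) ⟩
    ⌊log₂ (2 * (2 * k)) ⌋ ≡⟨ ⌊log₂[2*b]⌋≡1+⌊log₂b⌋ (2 * k) ⟩
    1 + ⌊log₂ (2 * k) ⌋   ≡⟨ cong suc (⌊log₂[2*b]⌋≡1+⌊log₂b⌋ k) ⟩
    2 + L                 ≤⟨ +-monoˡ-≤ L 2≤L ⟩
    L + L                 ∎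

funToFin-cong : ∀ {m n} {f g : Fin m → Fin n} → f ≗ g → funToFin f ≡ funToFin g
funToFin-cong {zero}  f≗g = refl
funToFin-cong {suc m} f≗g = cong₂ combine (f≗g Fin.zero) (funToFin-cong (f≗g ∘ Fin.suc))
  where import Data.Fin as Fin

finToFun-injective : ∀ {m n} {c d : Fin (n ^ m)} → finToFun {n} {m} c ≗ finToFun d → c ≡ d
finToFun-injective {m} {n} {c} {d} eq = begin
  c                             ≡⟨ funToFin-finToFin {m} {n} c ⟨
  funToFin (finToFun {n} {m} c) ≡⟨ funToFin-cong eq ⟩
  funToFin (finToFun {n} {m} d) ≡⟨ funToFin-finToFin {m} {n} d ⟩
  d                             ∎
  where open ≡-Reasoning

data Role (k : ℕ) : Set where
  anchor hub item : Fin k → Role k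
  padding : Role k

link : ∀ {k} → (Fin k → Fin k) → Role k → Role k → Bool
link f (hub j) (anchor j′) = ⌊ j ≟ j′ ⌋
link f (hub j) (item i)    = ⌊ j ≟ f i ⌋
link f _       _           = false

edge : ∀ {k} → (Fin k → Fin k) → Role k → Role k → Bool
edge f a b = link f a b ∨ link f b a

edge-irrefl : ∀ {k} (f : Fin k → Fin k) a → edge f a a ≡ false
edge-irrefl f (anchor _) = refl
edge-irrefl f (hub _)    = refl
edge-irrefl f (item _)   = refl
edge-irrefl f padding    = refl

module HardInstance (k r : ℕ) where

  N : ℕ
  N = k + (k + (k + r))

  -- Vertices are laid out as k anchors, k hubs, k items and r isolated padding vertices.
  role : Fin N → Role k
  role u = [ anchor , [ hub , [ item , const padding ]′ ∘ splitAt k ]′ ∘ splitAt k ]′ (splitAt k u)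

  anchorᵛ hubᵛ itemᵛ : Fin k → Fin N
  anchorᵛ j = j ↑ˡ (k + (k + r))
  hubᵛ    j = k ↑ʳ (j ↑ˡ (k + r))
  itemᵛ   i = k ↑ʳ (k ↑ʳ (i ↑ˡ r))

  role-anchorᵛ : ∀ j → role (anchorᵛ j) ≡ anchor j
  role-anchorᵛ j rewrite splitAt-↑ˡ k j (k + (k + r)) = refl

  role-hubᵛ : ∀ j → role (hubᵛ j) ≡ hub j
  role-hubᵛ j rewrite splitAt-↑ʳ k (k + (k + r)) (j ↑ˡ (k + r)) | splitAt-↑ˡ k j (k + r) = refl

  role-itemᵛ : ∀ i → role (itemᵛ i) ≡ item i
  role-itemᵛ i rewrite splitAt-↑ʳ k (k + (k + r)) (k ↑ʳ (i ↑ˡ r))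
                     | splitAt-↑ʳ k (k + r) (i ↑ˡ r) | splitAt-↑ˡ k i r = refl

  itemᵛ≢anchorᵛ : ∀ i j → itemᵛ i ≢ anchorᵛ j
  itemᵛ≢anchorᵛ i j eq with () ← trans (sym (role-itemᵛ i)) (trans (cong role eq) (role-anchorᵛ j))

  graph : (Fin k → Fin k) → Graph N
  graph f = record
    { adj    = λ u v → edge f (role u) (role v)
    ; sym    = λ u v → ∨-comm (link f (role u) (role v)) _
    ; irrefl = λ v → edge-irrefl f (role v)
    }

  twins : ∀ f i → SameNbhd (graph f) (itemᵛ i) (anchorᵛ (f i))
  twins f i w rewrite role-itemᵛ i | role-anchorᵛ (f i) with role w
  ... | anchor _ = refl
  ... | hub _    = refl
  ... | item _   = refl
  ... | padding  = refl

  twins⇒ : ∀ f i j → SameNbhd (graph f) (itemᵛ i) (anchorᵛ j) → j ≡ f i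
  -- Hub j is a neighbour of anchor j, and of item i only if j = f i.
  twins⇒ f i j same = toWitness (subst T (sym hubEdges) (fromWitness refl))
    where
    open ≡-Reasoning
    hubEdges : ⌊ j ≟ f i ⌋ ≡ ⌊ j ≟ j ⌋
    hubEdges = begin
      ⌊ j ≟ f i ⌋                               ≡⟨ cong₂ (edge f) (role-itemᵛ i) (role-hubᵛ j) ⟨
      edge f (role (itemᵛ i)) (role (hubᵛ j))   ≡⟨ same (hubᵛ j) ⟩
      edge f (role (anchorᵛ j)) (role (hubᵛ j)) ≡⟨ cong₂ (edge f) (role-anchorᵛ j) (role-hubᵛ j) ⟩
      ⌊ j ≟ j ⌋                                 ∎

module _ {k r s m} (A : StreamAlg (HardInstance.N k r) s m) where
  open HardInstance k r

  correctRuns-determine : ∀ f g {π ρ} → Correct A (graph f) π ρ → Correct A (graph g) π ρ →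
                          run A ρ (graph f) π ≡ run A ρ (graph g) π → f ≗ g
  correctRuns-determine f g {π} {ρ} correct-f correct-g sameState i = twins⇒ g i (f i) g-twins
    where
    u = itemᵛ i
    v = anchorᵛ (f i)
    f-reports : out A ρ (run A ρ (graph f) π) u v ≡ true
    f-reports = proj₂ (correct-f u v (itemᵛ≢anchorᵛ i (f i))) (twins f i)
    g-twins : SameNbhd (graph g) u v
    g-twins = proj₁ (correct-g u v (itemᵛ≢anchorᵛ i (f i)))
                (subst (λ σ → out A ρ σ u v ≡ true) sameState f-reports)

  private
    instanceOf : Fin (k ^ k) → Graph N
    instanceOf c = graph (finToFun c)

    Good? : ∀ c ρ → Dec (Correct A (instanceOf c) Perm.id ρ)
    Good? c = Correct? A (instanceOf c) Perm.id

  goodInstances≤2^s : ∀ ρ → count (λ c → Good? c ρ) (allFin (k ^ k)) ≤ 2 ^ s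
  goodInstances≤2^s ρ = subst (_≤ 2 ^ s) (length-map finalState goodCodes)
    (Unique⇒length≤2^ s (map-injectiveOn⁺ finalState
       (λ {c} {d} good-c good-d →
         finToFun-injective ∘ correctRuns-determine (finToFun c) (finToFun d) {Perm.id} {ρ} good-c good-d)
       (all-filter (λ c → Good? c ρ) (allFin _))
       (Unique.filter⁺ (λ c → Good? c ρ) (Unique.allFin⁺ _))))
    where
    finalState : Fin (k ^ k) → Vec Bool s
    finalState c = run A ρ (instanceOf c) Perm.id
    goodCodes = filter (λ c → Good? c ρ) (allFin (k ^ k))

  spaceBound : 1 ≤ m → Succeeds A → 3 * k ^ k ≤ 4 * 2 ^ s
  spaceBound (s≤s _) succeeds = *-cancelʳ-≤ (3 * k ^ k) (4 * 2 ^ s) m (begin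
    3 * k ^ k * m                                     ≡⟨ *-Props.xy∙z≈y∙xz 3 (k ^ k) m ⟩
    k ^ k * (3 * m)                                   ≡⟨ cong (_* (3 * m)) (length-allFin (k ^ k)) ⟨
    length codes * (3 * m)                            ≤⟨ sum-map-≥ seedsGoodFor 4 codes succeedsOnInstances ⟩
    4 * sum (map (λ c → count (Good? c) seeds) codes) ≡⟨ cong (4 *_) (sum-count-swap Good? codes seeds) ⟩
    4 * sum (map codesGoodFor seeds)                  ≤⟨ *-monoʳ-≤ 4 (sum-map-≤ codesGoodFor seeds goodInstances≤2^s) ⟩
    4 * (length seeds * 2 ^ s)                        ≡⟨ cong (λ l → 4 * (l * 2 ^ s)) (length-allFin m) ⟩
    4 * (m * 2 ^ s)                                   ≡⟨ *-Props.x∙yz≈xz∙y 4 m (2 ^ s) ⟩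
    4 * 2 ^ s * m                                     ∎)
    where
    open ≤-Reasoning
    codes = allFin (k ^ k)
    seeds = allFin m
    seedsGoodFor : Fin (k ^ k) → ℕ
    seedsGoodFor c = goodSeeds A (instanceOf c) Perm.id
    succeedsOnInstances : ∀ c → 3 * m ≤ 4 * seedsGoodFor c
    succeedsOnInstances c = succeeds (instanceOf c) Perm.id
    codesGoodFor : Fin m → ℕ
    codesGoodFor ρ = column Good? ρ codes
    length-allFin : ∀ n → length (allFin n) ≡ n
    length-allFin n = length-tabulate {n = n} id

spaceLowerBound : ∀ k r {s m} → 4 ≤ k → r ≤ k → 1 ≤ m →
                  (A : StreamAlg (k + (k + (k + r))) s m) → Succeeds A →
                  (k + (k + (k + r))) * ⌊log₂ (k + (k + (k + r))) ⌋ ≤ 16 * s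
spaceLowerBound k r {s} 4≤k r≤k 1≤m A succeeds =
  n⌊log₂n⌋≤16s {s = s} 4≤k n≤4k (spaceBound {k} {r} A 1≤m succeeds)
  where
  n≤4k : k + (k + (k + r)) ≤ 4 * k
  n≤4k = +-monoʳ-≤ k (+-monoʳ-≤ k (+-monoʳ-≤ k (≤-trans r≤k (≤-reflexive (sym (+-identityʳ k))))))

mainTheorem4 : ∃ λ (c : ℕ) → ∃ λ (N : ℕ) →
    ∀ (n s m : ℕ) → N ≤ n → 1 ≤ m → (A : StreamAlg n s m) → Succeeds A →
      n * ⌊log₂ n ⌋ ≤ c * s
mainTheorem4 = 16 , 12 , bound
  where
  bound : ∀ n s m → 12 ≤ n → 1 ≤ m → (A : StreamAlg n s m) → Succeeds A →
          n * ⌊log₂ n ⌋ ≤ 16 * s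
  bound n s m 12≤n 1≤m =
    subst (λ n → (A : StreamAlg n s m) → Succeeds A → n * ⌊log₂ n ⌋ ≤ 16 * s) (sym n≡3k+r)
      (spaceLowerBound k r 4≤k r≤k 1≤m)
    where
    k = n / 3
    r = n % 3
    4≤k : 4 ≤ k
    4≤k = /-monoˡ-≤ 3 12≤n
    r≤k : r ≤ k
    r≤k = ≤-trans (≤-trans (m%n≤n n 3) (n≤1+n 3)) 4≤k
    n≡3k+r : n ≡ k + (k + (k + r))
    n≡3k+r = trans (m≡m%n+[m/n]*n n 3) (regroup r k)
      where
      regroup : ∀ r k → r + k * 3 ≡ k + (k + (k + r))
      regroup = solve-∀
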